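{- Let $n$ be a positive integer, $B=\{\sigma(0,j,n):1\le j\le n-1\}$ and $S=\{\sigma(i,j,k): 1\le i<j<k\le n-1\}$. No edge of the Cayley graph $\mathrm{Cay}(\mathrm{Sym}_n,T_n)$ has one endpoint in $B$ and the other in $S$.
   Context: $\mathrm{Sym}_n$ is the symmetric group on $[n]$, permutations in one-line notation, $(\pi\circ\rho)(t)=\pi(\rho(t))$. For integers $0\le i<j<k\le n$ the block transposition $\sigma(i,j,k)$ is $[1\cdots i\ \ j+1\cdots k\ \ i+1\cdots j\ \ k+1\cdots n]$; $T_n$ is the set of all block transpositions. $\mathrm{Cay}(\mathrm{Sym}_n,T_n)$ has vertex set $\mathrm{Sym}_n$, with $\pi\sim\rho$ iff $\rho=\pi\circ\sigma$ for some $\sigma\in T_n$. -}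

module Defs where

open import Data.Nat using (ℕ; zero; suc; _+_; _∸_; _≤_; _<_; _≤ᵇ_)
open import Data.Bool using (if_then_else_)
open import Data.Fin using (Fin; toℕ)
open import Data.Product using (Σ; ∃; _×_; _,_)
open import Relation.Binary.PropositionalEquality using (_≡_)
open import Function using (_∘_)

-- A permutation of [n] in one-line notation is stored as a function on
-- positions: position t (1-based) is represented by the Fin n index t-1,
-- and the value π(t) likewise.
Perm : ℕ → Set
Perm n = Fin n → Fin n

_≐_ : ∀ {n} → Perm n → Perm n → Set
π ≐ ρ = ∀ t → π t ≡ ρ t

-- The value (1-based, as a natural number) at 1-based position t of the
-- block transposition σ(i,j,k) = [1..i, j+1..k, i+1..j, k+1..n]:
--   t ≤ i            ↦ t
--   i < t ≤ i+(k-j)  ↦ t + (j - i)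
--   i+(k-j) < t ≤ k  ↦ t - (k - j)
--   k < t            ↦ t
blockVal : ℕ → ℕ → ℕ → ℕ → ℕ
blockVal i j k t =
  if t ≤ᵇ i then t
  else if t ≤ᵇ i + (k ∸ j) then t + (j ∸ i)
  else if t ≤ᵇ k then t ∸ (k ∸ j)
  else t

IsBlock : ∀ {n} → ℕ → ℕ → ℕ → Perm n → Set
IsBlock i j k σ = ∀ t → suc (toℕ (σ t)) ≡ blockVal i j k (suc (toℕ t))

InT : ∀ n → Perm n → Set
InT n σ = Σ ℕ λ i → Σ ℕ λ j → Σ ℕ λ k →
  (i < j) × (j < k) × (k ≤ n) × IsBlock i j k σ

InB : ∀ n → Perm n → Set
InB n π = Σ ℕ λ j → (1 ≤ j) × (j < n) × IsBlock 0 j n π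

InS : ∀ n → Perm n → Set
InS n π = Σ ℕ λ i → Σ ℕ λ j → Σ ℕ λ k →
  (1 ≤ i) × (i < j) × (j < k) × (k < n) × IsBlock i j k π

Adj : ∀ n → Perm n → Perm n → Set
Adj n π ρ = Σ (Perm n) λ σ → InT n σ × (ρ ≐ (π ∘ σ))

-- B consists of the rotations r_a = σ(0,a,n) with 1 ≤ a < n, each of which
-- moves both 1 and n, while every element of S fixes 1 and n and sends i+1 to
-- j+1.  Let ρ = π ∘ σ with σ = σ(i,j,k).  If i ≥ 1 then σ fixes 1, and if
-- k < n then σ fixes n; either way π and ρ agree at that point, which is
-- impossible when exactly one of them is a rotation.  Otherwise σ = r_b is a
-- rotation itself.  A composite r_a ∘ r_b that fixes 1 has a + b = n and is
-- then the identity, so the element of S, which is r_a ∘ r_b (when π = r_a)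
-- or r_a ∘ r_b⁻¹ (when ρ = r_a) and fixes 1, is the identity; but it moves i+1.
module Submission where

open import Data.Bool using (true; false; T)
open import Data.Fin using (Fin; toℕ; fromℕ<)
open import Data.Fin.Properties using (toℕ-fromℕ<)
open import Data.Nat
open import Data.Nat.Properties
open import Data.Product using (_×_; _,_; proj₁; proj₂)
open import Data.Sum using (inj₁; inj₂)
open import Function using (_∘_)
open import Relation.Nullary using (¬_; yes; no; contradiction)
open import Relation.Binary.PropositionalEquality

open import Defs

private
  variable
    i j k n t : ℕ

≤ᵇ-true : ∀ {m n} → m ≤ n → (m ≤ᵇ n) ≡ true
≤ᵇ-true {m} {n} m≤n with m ≤ᵇ n | ≤⇒≤ᵇ m≤n
... | true | _ = refl

≤ᵇ-false : ∀ {m n} → n < m → (m ≤ᵇ n) ≡ false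
≤ᵇ-false {m} {n} n<m with m ≤ᵇ n in eq
... | false = refl
... | true  = contradiction (≤ᵇ⇒≤ m n (subst T (sym eq) _)) (<⇒≱ n<m)

blockVal-fixes-prefix : t ≤ i → blockVal i j k t ≡ t
blockVal-fixes-prefix t≤i rewrite ≤ᵇ-true t≤i = refl

blockVal-raises : i < t → t ≤ i + (k ∸ j) → blockVal i j k t ≡ t + (j ∸ i)
blockVal-raises i<t t≤i+[k∸j] rewrite ≤ᵇ-false i<t | ≤ᵇ-true t≤i+[k∸j] = refl

blockVal-lowers : i + (k ∸ j) < t → t ≤ k → blockVal i j k t ≡ t ∸ (k ∸ j)
blockVal-lowers {i} {k} {j} i+[k∸j]<t t≤k
  rewrite ≤ᵇ-false (≤-<-trans (m≤m+n i (k ∸ j)) i+[k∸j]<t) | ≤ᵇ-false i+[k∸j]<t | ≤ᵇ-true t≤k = refl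

+-∸-≤ : i ≤ j → j ≤ k → i + (k ∸ j) ≤ k
+-∸-≤ {i} {j} {k} i≤j j≤k = ≤-trans (+-monoˡ-≤ (k ∸ j) i≤j) (≤-reflexive (m+[n∸m]≡n j≤k))

blockVal-fixes-suffix : i ≤ j → j ≤ k → k < t → blockVal i j k t ≡ t
blockVal-fixes-suffix {i} {j} {k} i≤j j≤k k<t
  rewrite ≤ᵇ-false (≤-<-trans (≤-trans (m≤m+n i (k ∸ j)) (+-∸-≤ i≤j j≤k)) k<t)
        | ≤ᵇ-false (≤-<-trans (+-∸-≤ i≤j j≤k) k<t) | ≤ᵇ-false k<t = refl

blockVal-sends-suc : i < j → j < k → blockVal i j k (suc i) ≡ suc j
blockVal-sends-suc {i} {j} {k} i<j j<k =
  trans (blockVal-raises ≤-refl suc-i≤) (cong suc (m+[n∸m]≡n (<⇒≤ i<j)))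
  where
  suc-i≤ : suc i ≤ i + (k ∸ j)
  suc-i≤ = ≤-trans (≤-reflexive (+-comm 1 i)) (+-monoʳ-≤ i (m<n⇒0<n∸m j<k))

rotate : ℕ → ℕ → ℕ → ℕ
rotate n a = blockVal 0 a n

private
  variable
    a b : ℕ

rotate-start : 1 ≤ t → t ≤ n ∸ a → rotate n a t ≡ t + a
rotate-start = blockVal-raises

rotate-end : n ∸ a < t → t ≤ n → rotate n a t ≡ t ∸ (n ∸ a)
rotate-end = blockVal-lowers

rotate-one : a < n → rotate n a 1 ≡ suc a
rotate-one a<n = rotate-start ≤-refl (m<n⇒0<n∸m a<n)

rotate-last : 1 ≤ a → a ≤ n → rotate n a n ≡ a
rotate-last {a} {n} 1≤a a≤n =
  trans (rotate-end (∸-monoʳ-< 1≤a a≤n) ≤-refl) (m∸[m∸n]≡n a≤n)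

rotate-moves-one : 1 ≤ a → a < n → rotate n a 1 ≢ 1
rotate-moves-one 1≤a a<n eq = <⇒≢ 1≤a (sym (suc-injective (trans (sym (rotate-one a<n)) eq)))

rotate-moves-last : 1 ≤ a → a < n → rotate n a n ≢ n
rotate-moves-last 1≤a a<n eq = <⇒≢ a<n (trans (sym (rotate-last 1≤a (<⇒≤ a<n))) eq)

rotate-bounded : a ≤ n → 1 ≤ t → t ≤ n → 1 ≤ rotate n a t × rotate n a t ≤ n
rotate-bounded {a} {n} {t} a≤n 1≤t t≤n with t ≤? n ∸ a
... | yes t≤n∸a rewrite rotate-start {n = n} {a = a} 1≤t t≤n∸a =
  ≤-trans 1≤t (m≤m+n t a) , ≤-trans (+-monoˡ-≤ a t≤n∸a) (≤-reflexive (m∸n+n≡m a≤n))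
... | no t≰n∸a rewrite rotate-end {n = n} {a = a} (≰⇒> t≰n∸a) t≤n =
  m<n⇒0<n∸m (≰⇒> t≰n∸a) , ≤-trans (m∸n≤m t (n ∸ a)) t≤n

rotate-inverse : ∀ a b → a + b ≡ n → 1 ≤ t → t ≤ n → rotate n a (rotate n b t) ≡ t
rotate-inverse {t = t} a b refl 1≤t t≤n with t ≤? a
... | yes t≤a = begin
  rotate (a + b) a (rotate (a + b) b t)
    ≡⟨ cong (rotate (a + b) a) (rotate-start 1≤t (subst (t ≤_) (sym (m+n∸n≡m a b)) t≤a)) ⟩
  rotate (a + b) a (t + b)
    ≡⟨ rotate-end (subst (_< t + b) (sym (m+n∸m≡n a b)) (+-monoˡ-≤ b 1≤t)) (+-monoˡ-≤ b t≤a) ⟩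
  t + b ∸ (a + b ∸ a)
    ≡⟨ cong (t + b ∸_) (m+n∸m≡n a b) ⟩
  t + b ∸ b
    ≡⟨ m+n∸n≡m t b ⟩
  t ∎
  where open ≡-Reasoning
... | no t≰a = begin
  rotate (a + b) a (rotate (a + b) b t)
    ≡⟨ cong (rotate (a + b) a) (rotate-end (subst (_< t) (sym (m+n∸n≡m a b)) a<t) t≤n) ⟩
  rotate (a + b) a (t ∸ (a + b ∸ b))
    ≡⟨ cong (λ s → rotate (a + b) a (t ∸ s)) (m+n∸n≡m a b) ⟩
  rotate (a + b) a (t ∸ a)
    ≡⟨ rotate-start (m<n⇒0<n∸m a<t) (∸-monoˡ-≤ a t≤n) ⟩
  t ∸ a + a
    ≡⟨ m∸n+n≡m (<⇒≤ a<t) ⟩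
  t ∎
  where
  open ≡-Reasoning
  a<t : a < t
  a<t = ≰⇒> t≰a

rotate∘rotate-fixes-one⇒+≡ : 1 ≤ a → a ≤ n → b < n → rotate n a (rotate n b 1) ≡ 1 → a + b ≡ n
rotate∘rotate-fixes-one⇒+≡ {a} {n} {b} 1≤a a≤n b<n fixes = begin
  a + b            ≡⟨ cong (a +_) (suc-injective b+1≡n∸a+1) ⟩
  a + (n ∸ a)      ≡⟨ m+[n∸m]≡n a≤n ⟩
  n                ∎
  where
  open ≡-Reasoning
  b+1≡n∸a+1 : suc b ≡ suc (n ∸ a)
  b+1≡n∸a+1 = begin
    suc b                                ≡⟨ sym (rotate-inverse (n ∸ a) a (m∸n+n≡m a≤n) (s≤s z≤n) b<n) ⟩
    rotate n (n ∸ a) (rotate n a (suc b)) ≡⟨ cong (rotate n (n ∸ a) ∘ rotate n a) (sym (rotate-one b<n)) ⟩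
    rotate n (n ∸ a) (rotate n a (rotate n b 1)) ≡⟨ cong (rotate n (n ∸ a)) fixes ⟩
    rotate n (n ∸ a) 1                   ≡⟨ rotate-one (∸-monoʳ-< 1≤a a≤n) ⟩
    suc (n ∸ a)                          ∎

position : ∀ {n} t → 1 ≤ t → t ≤ n → Fin n
position (suc t) _ t<n = fromℕ< t<n

IsBlock-position : {σ : Perm n} → IsBlock i j k σ → (1≤t : 1 ≤ t) (t≤n : t ≤ n) →
  suc (toℕ (σ (position t 1≤t t≤n))) ≡ blockVal i j k t
IsBlock-position {i = i} {j} {k} {t = suc t} σ-block _ t<n =
  trans (σ-block _) (cong (blockVal i j k ∘ suc) (toℕ-fromℕ< t<n))

infix 4 _≗_on_
_≗_on_ : (ℕ → ℕ) → (ℕ → ℕ) → ℕ → Set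
f ≗ g on n = ∀ t → 1 ≤ t → t ≤ n → f t ≡ g t

IsBlock-∘ : ∀ {i′ j′ k′ i″ j″ k″} {π σ ρ : Perm n} →
  IsBlock i j k π → IsBlock i′ j′ k′ σ → IsBlock i″ j″ k″ ρ → ρ ≐ (π ∘ σ) →
  blockVal i″ j″ k″ ≗ blockVal i j k ∘ blockVal i′ j′ k′ on n
IsBlock-∘ {i = i} {j} {k} {i′} {j′} {k′} {i″} {j″} {k″} {π = π} {σ} {ρ}
  π-block σ-block ρ-block ρ≐π∘σ t 1≤t t≤n = begin
  blockVal i″ j″ k″ t                 ≡⟨ sym (IsBlock-position ρ-block 1≤t t≤n) ⟩
  suc (toℕ (ρ x))                     ≡⟨ cong (suc ∘ toℕ) (ρ≐π∘σ x) ⟩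
  suc (toℕ (π (σ x)))                 ≡⟨ π-block (σ x) ⟩
  blockVal i j k (suc (toℕ (σ x)))    ≡⟨ cong (blockVal i j k) (IsBlock-position σ-block 1≤t t≤n) ⟩
  blockVal i j k (blockVal i′ j′ k′ t) ∎
  where
  open ≡-Reasoning
  x = position t 1≤t t≤n

rotate∘rotate-not-inner : 1 ≤ a → a < n → 1 ≤ i → i < j → j < k → k < n → b < n →
  ¬ (blockVal i j k ≗ rotate n a ∘ rotate n b on n)
rotate∘rotate-not-inner {a} {n} {i} {j} {k} {b} 1≤a a<n 1≤i i<j j<k k<n b<n ρ≗ =
  <⇒≢ i<j (suc-injective (begin
    suc i                           ≡⟨ sym (rotate-inverse a b a+b≡n (s≤s z≤n) i<n) ⟩
    rotate n a (rotate n b (suc i)) ≡⟨ sym (ρ≗ (suc i) (s≤s z≤n) i<n) ⟩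
    blockVal i j k (suc i)          ≡⟨ blockVal-sends-suc i<j j<k ⟩
    suc j                           ∎))
  where
  open ≡-Reasoning
  i<n : i < n
  i<n = <-trans i<j (<-trans j<k k<n)
  a+b≡n : a + b ≡ n
  a+b≡n = rotate∘rotate-fixes-one⇒+≡ 1≤a (<⇒≤ a<n) b<n
    (trans (sym (ρ≗ 1 ≤-refl (≤-trans 1≤a (<⇒≤ a<n)))) (blockVal-fixes-prefix 1≤i))

rotate∘block-not-inner : ∀ {i′ j′ k′} → 1 ≤ a → a < n →
  1 ≤ i → i < j → j < k → k < n → i′ < j′ → j′ < k′ → k′ ≤ n →
  ¬ (blockVal i j k ≗ rotate n a ∘ blockVal i′ j′ k′ on n)
rotate∘block-not-inner {a} {n} {i} {j} {k} {suc i′} {j′} {k′} 1≤a a<n 1≤i _ _ _ _ _ _ ρ≗ =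
  rotate-moves-one 1≤a a<n (begin
    rotate n a 1
      ≡⟨ cong (rotate n a) (sym (blockVal-fixes-prefix {t = 1} {i = suc i′} {j = j′} {k = k′} (s≤s z≤n))) ⟩
    rotate n a (blockVal (suc i′) j′ k′ 1) ≡⟨ sym (ρ≗ 1 ≤-refl (≤-trans 1≤a (<⇒≤ a<n))) ⟩
    blockVal i j k 1                       ≡⟨ blockVal-fixes-prefix 1≤i ⟩
    1                                      ∎)
  where open ≡-Reasoning
rotate∘block-not-inner {a} {n} {i} {j} {k} {zero} {j′} {k′} 1≤a a<n 1≤i i<j j<k k<n _ j′<k′ k′≤n ρ≗
  with m≤n⇒m<n∨m≡n k′≤n
... | inj₁ k′<n = rotate-moves-last 1≤a a<n (begin
    rotate n a n
      ≡⟨ cong (rotate n a) (sym (blockVal-fixes-suffix {t = n} z≤n (<⇒≤ j′<k′) k′<n)) ⟩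
    rotate n a (blockVal 0 j′ k′ n) ≡⟨ sym (ρ≗ n (≤-trans 1≤a (<⇒≤ a<n)) ≤-refl) ⟩
    blockVal i j k n                ≡⟨ blockVal-fixes-suffix (<⇒≤ i<j) (<⇒≤ j<k) k<n ⟩
    n                               ∎)
  where open ≡-Reasoning
... | inj₂ refl = rotate∘rotate-not-inner 1≤a a<n 1≤i i<j j<k k<n j′<k′ ρ≗

inner∘rotate-not-rotate : 1 ≤ a → a < n → 1 ≤ i → i < j → j < k → k < n → 1 ≤ b → b < n →
  ¬ (rotate n a ≗ blockVal i j k ∘ rotate n b on n)
inner∘rotate-not-rotate {a} {n} {i} {j} {k} {b} 1≤a a<n 1≤i i<j j<k k<n 1≤b b<n ρ≗ =
  <⇒≢ i<j (suc-injective (begin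
    suc i                          ≡⟨ sym (rotate-inverse b c b+c≡n (s≤s z≤n) i<n) ⟩
    rotate n b s                   ≡⟨ cong (λ x → rotate n x s) (sym a≡b) ⟩
    rotate n a s                   ≡⟨ ρ≗ s (proj₁ s-bounded) (proj₂ s-bounded) ⟩
    blockVal i j k (rotate n b s)  ≡⟨ cong (blockVal i j k) (rotate-inverse b c b+c≡n (s≤s z≤n) i<n) ⟩
    blockVal i j k (suc i)         ≡⟨ blockVal-sends-suc i<j j<k ⟩
    suc j                          ∎))
  where
  open ≡-Reasoning
  1≤n : 1 ≤ n
  1≤n = ≤-trans 1≤a (<⇒≤ a<n)
  i<n : i < n
  i<n = <-trans i<j (<-trans j<k k<n)
  c : ℕ
  c = n ∸ b
  b+c≡n : b + c ≡ n
  b+c≡n = m+[n∸m]≡n (<⇒≤ b<n)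
  s : ℕ
  s = rotate n c (suc i)
  s-bounded : 1 ≤ s × s ≤ n
  s-bounded = rotate-bounded (m∸n≤m n b) (s≤s z≤n) i<n
  a+c≡n : a + c ≡ n
  a+c≡n = rotate∘rotate-fixes-one⇒+≡ 1≤a (<⇒≤ a<n) (∸-monoʳ-< 1≤b (<⇒≤ b<n)) (begin
    rotate n a (rotate n c 1)                 ≡⟨ ρ≗ _ (proj₁ bounded) (proj₂ bounded) ⟩
    blockVal i j k (rotate n b (rotate n c 1)) ≡⟨ cong (blockVal i j k) (rotate-inverse b c b+c≡n ≤-refl 1≤n) ⟩
    blockVal i j k 1                          ≡⟨ blockVal-fixes-prefix 1≤i ⟩
    1                                         ∎)
    where bounded = rotate-bounded (m∸n≤m n b) ≤-refl 1≤n
  a≡b : a ≡ b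
  a≡b = begin
    a               ≡⟨ sym (m+n∸n≡m a c) ⟩
    a + c ∸ c       ≡⟨ cong (_∸ c) a+c≡n ⟩
    n ∸ (n ∸ b)     ≡⟨ m∸[m∸n]≡n (<⇒≤ b<n) ⟩
    b               ∎

inner∘block-not-rotate : ∀ {i′ j′ k′} → 1 ≤ a → a < n →
  1 ≤ i → i < j → j < k → k < n → i′ < j′ → j′ < k′ → k′ ≤ n →
  ¬ (rotate n a ≗ blockVal i j k ∘ blockVal i′ j′ k′ on n)
inner∘block-not-rotate {a} {n} {i} {j} {k} {suc i′} {j′} {k′} 1≤a a<n 1≤i _ _ _ _ _ _ ρ≗ =
  rotate-moves-one 1≤a a<n (begin
    rotate n a 1                               ≡⟨ ρ≗ 1 ≤-refl (≤-trans 1≤a (<⇒≤ a<n)) ⟩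
    blockVal i j k (blockVal (suc i′) j′ k′ 1)
      ≡⟨ cong (blockVal i j k) (blockVal-fixes-prefix {t = 1} {i = suc i′} {j = j′} {k = k′} (s≤s z≤n)) ⟩
    blockVal i j k 1                           ≡⟨ blockVal-fixes-prefix 1≤i ⟩
    1                                          ∎)
  where open ≡-Reasoning
inner∘block-not-rotate {a} {n} {i} {j} {k} {zero} {j′} {k′} 1≤a a<n 1≤i i<j j<k k<n 0<j′ j′<k′ k′≤n ρ≗
  with m≤n⇒m<n∨m≡n k′≤n
... | inj₁ k′<n = rotate-moves-last 1≤a a<n (begin
    rotate n a n                        ≡⟨ ρ≗ n (≤-trans 1≤a (<⇒≤ a<n)) ≤-refl ⟩
    blockVal i j k (blockVal 0 j′ k′ n)
      ≡⟨ cong (blockVal i j k) (blockVal-fixes-suffix {t = n} z≤n (<⇒≤ j′<k′) k′<n) ⟩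
    blockVal i j k n                    ≡⟨ blockVal-fixes-suffix (<⇒≤ i<j) (<⇒≤ j<k) k<n ⟩
    n                                   ∎)
  where open ≡-Reasoning
... | inj₂ refl = inner∘rotate-not-rotate 1≤a a<n 1≤i i<j j<k k<n 0<j′ j′<k′ ρ≗

lemma5 : (n : ℕ) → 1 ≤ n → (π ρ : Perm n) → Adj n π ρ →
    ¬ (InB n π × InS n ρ) × ¬ (InS n π × InB n ρ)
lemma5 n _ π ρ (σ , (i′ , j′ , k′ , i′<j′ , j′<k′ , k′≤n , σ-block) , ρ≐π∘σ) =
  (λ { ((a , 1≤a , a<n , π-block) , (i , j , k , 1≤i , i<j , j<k , k<n , ρ-block)) →
         rotate∘block-not-inner 1≤a a<n 1≤i i<j j<k k<n i′<j′ j′<k′ k′≤n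
           (IsBlock-∘ π-block σ-block ρ-block ρ≐π∘σ) })
  , (λ { ((i , j , k , 1≤i , i<j , j<k , k<n , π-block) , (a , 1≤a , a<n , ρ-block)) →
         inner∘block-not-rotate 1≤a a<n 1≤i i<j j<k k<n i′<j′ j′<k′ k′≤n
           (IsBlock-∘ π-block σ-block ρ-block ρ≐π∘σ) })
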